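{- Let $H$ be a graph and let $b,k,n\geq 2$ be integers. Suppose $c$ is a $b$-bounded edge-colouring of $K_n$ using $C$ colours which contains no $k$-repeat of $H$ (with respect to $c$, whose restriction to a copy of $H$ need not be proper). Then $c$ can be refined to a proper edge-colouring of $K_n$ with at most $(b+1)C$ colours containing no $k$-repeat of $H$; here refinement means each colour class of the new colouring is contained in a colour class of $c$.
   Context: An edge-colouring (not necessarily proper) of $K_n$ is $b$-bounded if every colour class, viewed as a graph, has maximum degree at most $b$. A colouring is proper if any two edges sharing a vertex receive different colours. Two copies of $H$ in an edge-coloured $K_n$ are colour isomorphic if there is a graph isomorphism between them mapping each edge to an edge of the same colour. A $k$-repeat of $H$ is a collection of $k$ pairwise vertex-disjoint, pairwise colour-isomorphic copies of $H$. -}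

module Defs where

open import Data.Nat using (ℕ; suc; _≤_)
open import Data.Fin using (Fin)
open import Data.Fin.Properties using (_≟_)
open import Data.List using (length; filter)
open import Data.List using () renaming (allFin to allFinL)
open import Data.Product using (Σ; _×_; _,_)
open import Data.Empty using (⊥)
open import Relation.Nullary using (¬_; ¬?)
open import Relation.Nullary.Decidable using (_×-dec_)
open import Relation.Binary.PropositionalEquality using (_≡_; _≢_)
open import Function.Bundles using (_↔_; Inverse)
open import Function.Definitions using (Injective)
open import Level using (0ℓ)

record Graph : Set₁ where
  field
    size  : ℕ
    Adj   : Fin size → Fin size → Set
    sym   : ∀ {x y} → Adj x y → Adj y x
    irrefl : ∀ {x} → ¬ Adj x x
open Graph public

-- An edge-colouring of K_n with colours in Fin C: a symmetric function on
-- pairs of vertices; only its values on pairs of distinct vertices matter.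
record Colouring (n C : ℕ) : Set where
  field
    col : Fin n → Fin n → Fin C
    col-sym : ∀ u v → col u v ≡ col v u
open Colouring public

colourDeg : ∀ {n C} → Colouring n C → Fin n → Fin C → ℕ
colourDeg c v α =
  length (filter (λ u → ¬? (u ≟ v) ×-dec (col c v u ≟ α)) (allFinL _))

Bounded : ∀ {n C} → ℕ → Colouring n C → Set
Bounded b c = ∀ v α → colourDeg c v α ≤ b

Proper : ∀ {n C} → Colouring n C → Set
Proper c = ∀ u v w → v ≢ u → w ≢ u → v ≢ w → col c u v ≢ col c u w

-- a copy of H in K_n: an injective map of the vertices of H into Fin n
-- (the copy has edges {f x, f y} for xy ∈ E(H))
Copy : Graph → ℕ → Set
Copy H n = Σ (Fin (size H) → Fin n) (λ f → Injective _≡_ _≡_ f)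

Disjoint : ∀ {H n} → Copy H n → Copy H n → Set
Disjoint {H} (f , _) (g , _) = ∀ (x y : Fin (size H)) → f x ≢ g y

-- colour isomorphic copies: an isomorphism between the copies f(H) and g(H)
-- corresponds exactly to g ∘ σ ∘ f⁻¹ for an automorphism σ of H; it must map
-- every edge to an edge of the same colour.
ColourIso : ∀ {H n C} → Colouring n C → Copy H n → Copy H n → Set
ColourIso {H} c (f , _) (g , _) =
  Σ (Fin (size H) ↔ Fin (size H)) λ (σ : Fin (size H) ↔ Fin (size H)) →
    let s : Fin (size H) → Fin (size H)
        s = Inverse.to σ in
    (∀ x y → (Adj H x y → Adj H (s x) (s y)) × (Adj H (s x) (s y) → Adj H x y))
    × (∀ x y → Adj H x y → col c (f x) (f y) ≡ col c (g (s x)) (g (s y)))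

Repeat : ∀ {n C} → Graph → ℕ → Colouring n C → Set
Repeat {n} H k c =
  Σ (Fin k → Copy H n) λ F →
    ∀ i j → i ≢ j → Disjoint {H} (F i) (F j) × ColourIso {H} c (F i) (F j)

Refines : ∀ {n C C'} → Colouring n C' → Colouring n C → Set
Refines {n} c' c = ∀ (u v u' v' : Fin n) → u ≢ v → u' ≢ v' →
  col c' u v ≡ col c' u' v' → col c u v ≡ col c u' v'

module Submission where

-- For every colour α of c, the edges of colour α form a graph G_α (classGraph c α) of maximum
-- degree at most b, so by Vizing's theorem G_α has a proper edge colouring φ_α with b + 1
-- colours.  The refined colouring gives the edge uv the pair (φ_α(uv), α), where α = c(uv),
-- encoded in Fin ((b + 1) * C).  Its second component is c, so it refines c; two edges at u
-- with the same pair have the same c-colour α and the same φ_α-colour, so they coincide.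
-- Finally a refinement can only destroy colour isomorphisms, so a k-repeat of H for the
-- refinement would be one for c.

open import Defs hiding (sym)
open import Data.Bool using (Bool; true; false; not; if_then_else_)
open import Data.Bool.Properties using (¬-not) renaming (_≟_ to _≟ᵇ_)
open import Data.Empty using (⊥; ⊥-elim)
open import Data.Fin using (Fin; toℕ; fromℕ<; combine) renaming (zero to fzero)
open import Data.Fin.Properties
  using (_≟_; any?; all?; ¬∀⟶∃¬; pigeonhole; injective⇒≤; toℕ<n; toℕ-fromℕ<;
         combine-injective; combine-injectiveʳ)
open import Data.List using (List; []; _∷_; filter; lookup; length; cartesianProduct; allFin)
open import Data.List.Membership.Propositional using (_∈_)
open import Data.List.Membership.Propositional.Properties
  using (∈-filter⁺; ∈-allFin; ∈-cartesianProduct⁺)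
open import Data.List.Relation.Unary.Any using (here; there; index)
open import Data.List.Relation.Unary.Any.Properties using (lookup-index)
open import Data.Maybe using (Maybe; just; nothing; fromMaybe) renaming (map to mapMaybe)
open import Data.Maybe.Properties using (just-injective) renaming (≡-dec to ≡-decMaybe)
open import Data.Nat
  using (ℕ; zero; suc; _≤_; _<_; _*_; _+_; _≤′_; ≤′-refl; ≤′-step; z≤n; s≤s; s≤s⁻¹)
open import Data.Nat.Properties
  using (≤-refl; ≤-trans; <-trans; ≤-<-trans; <⇒≤; <⇒≢; ≤-antisym; <-cmp; <-irrefl; n<1+n;
         m<n⇒m<1+n; m<1+n⇒m<n∨m≡n; ≤⇒≤′; ≮⇒≥; suc-injective; +-comm; anyUpTo?)
  renaming (_≟_ to _≟ℕ_; _<?_ to _<ℕ?_)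
open import Data.Product using (Σ; _×_; _,_; proj₁; proj₂; ∃; map₂)
open import Data.Sum using (_⊎_; inj₁; inj₂)
open import Function using (case_of_; _∘_)
open import Function.Bundles using (Inverse)
open import Function.Definitions using (Injective)
open import Relation.Binary using (Tri; tri<; tri≈; tri>)
open import Relation.Binary.PropositionalEquality
  using (_≡_; _≢_; refl; sym; trans; cong; subst)
open import Relation.Nullary using (¬_; Dec; yes; no; ¬?)
open import Relation.Nullary.Decidable using (_×-dec_; _⊎-dec_)

MaxDegree≤ : Graph → ℕ → Set
MaxDegree≤ G b =
  ∀ x (f : Fin (suc b) → Fin (size G)) → Injective _≡_ _≡_ f → ¬ (∀ i → Adj G x (f i))

-- A proper edge colouring of G with k colours (its values on non-edges are irrelevant).
record ProperEdgeColouring (G : Graph) (k : ℕ) : Set where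
  field
    colour        : Fin (size G) → Fin (size G) → Fin k
    colour-sym    : ∀ x y → colour x y ≡ colour y x
    colour-proper : ∀ {u v w} → Adj G u v → Adj G u w → colour u v ≡ colour u w → v ≡ w

leastBelow : (Q : ℕ → Set) → (∀ t → Dec (Q t)) → ∀ N →
  (Σ ℕ λ t → t < N × Q t × (∀ s → s < t → ¬ Q s)) ⊎ (∀ t → t < N → ¬ Q t)
leastBelow Q Q? zero = inj₂ λ t ()
leastBelow Q Q? (suc N) with leastBelow Q Q? N
... | inj₁ (t , t<N , q , least) = inj₁ (t , m<n⇒m<1+n t<N , q , least)
... | inj₂ none with Q? N
...   | yes q = inj₁ (N , ≤-refl , q , none)
...   | no ¬q = inj₂ noneUpToN
  where
  noneUpToN : ∀ t → t < suc N → ¬ Q t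
  noneUpToN t t<1+N with m<1+n⇒m<n∨m≡n t<1+N
  ... | inj₁ t<N = none t t<N
  ... | inj₂ refl = ¬q

just≢nothing : ∀ {A : Set} {a : A} → just a ≢ nothing
just≢nothing ()

justWitness : ∀ {A : Set} (m : Maybe A) → m ≢ nothing → Σ A λ a → m ≡ just a
justWitness (just a) _ = a , refl
justWitness nothing m≢nothing = ⊥-elim (m≢nothing refl)

module Vizing (G : Graph) (Adj? : ∀ x y → Dec (Adj G x y)) (b : ℕ) (maxDeg : MaxDegree≤ G b) where

  n : ℕ
  n = size G

  Palette : Set
  Palette = Fin (suc b)

  PartialColouring : Set
  PartialColouring = Fin n → Fin n → Maybe Palette

  _≟ₘ_ : (p q : Maybe Palette) → Dec (p ≡ q)
  _≟ₘ_ = ≡-decMaybe _≟_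

  record ProperPartial (ψ : PartialColouring) : Set where
    field
      symmetric : ∀ x y → ψ x y ≡ ψ y x
      on-edges  : ∀ x y γ → ψ x y ≡ just γ → Adj G x y
      proper    : ∀ x y z γ → ψ x y ≡ just γ → ψ x z ≡ just γ → y ≡ z
  open ProperPartial

  empty-proper : ProperPartial (λ _ _ → nothing)
  empty-proper = record { symmetric = λ _ _ → refl ; on-edges = λ _ _ _ () ; proper = λ _ _ _ _ () }

  Misses : PartialColouring → Fin n → Palette → Set
  Misses ψ x γ = ∀ y → ψ x y ≢ just γ

  misses? : ∀ ψ x γ → Dec (Misses ψ x γ)
  misses? ψ x γ = all? (λ y → ¬? (ψ x y ≟ₘ just γ))

  Extends : PartialColouring → PartialColouring → Set
  Extends ψ ψ' = ∀ x y → ψ x y ≢ nothing → ψ' x y ≢ nothing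

  Extension : PartialColouring → Fin n → Fin n → Set
  Extension ψ u v = Σ PartialColouring λ ψ' → ProperPartial ψ' × Extends ψ ψ' × ψ' u v ≢ nothing

  extension-after : ∀ {ψ ψ' u v} → Extends ψ ψ' → Extension ψ' u v → Extension ψ u v
  extension-after ext (ψ'' , proper'' , ext' , uv) =
    ψ'' , proper'' , (λ x y coloured → ext' x y (ext x y coloured)) , uv

  adj-distinct : ∀ {x y} → Adj G x y → x ≢ y
  adj-distinct a refl = irrefl G a

  -- A proper partial colouring uses at most b colours at x, so one of the b + 1 colours is
  -- missing there.
  missingColour : ∀ {ψ} → ProperPartial ψ → ∀ x → Σ Palette (Misses ψ x)
  missingColour {ψ} ψ-proper x =
    map₂ (λ unused y e → unused (y , e))
         (¬∀⟶∃¬ (suc b) Used (λ γ → any? λ y → ψ x y ≟ₘ just γ) notAllUsed)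
    where
    Used : Palette → Set
    Used γ = ∃ λ y → ψ x y ≡ just γ
    notAllUsed : ¬ (∀ γ → Used γ)
    notAllUsed used =
      maxDeg x (proj₁ ∘ used) distinct (λ γ → on-edges ψ-proper x _ γ (proj₂ (used γ)))
      where
      distinct : Injective _≡_ _≡_ (proj₁ ∘ used)
      distinct {γ} {δ} e =
        just-injective (trans (sym (proj₂ (used γ))) (trans (cong (ψ x) e) (proj₂ (used δ))))

  SameEdge : Fin n → Fin n → Fin n → Fin n → Set
  SameEdge a c x y = (x ≡ a × y ≡ c) ⊎ (x ≡ c × y ≡ a)

  sameEdge? : ∀ a c x y → Dec (SameEdge a c x y)
  sameEdge? a c x y = (x ≟ a ×-dec y ≟ c) ⊎-dec (x ≟ c ×-dec y ≟ a)

  sameEdge-sym : ∀ {a c x y} → SameEdge a c x y → SameEdge a c y x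
  sameEdge-sym (inj₁ (p , q)) = inj₂ (q , p)
  sameEdge-sym (inj₂ (p , q)) = inj₁ (q , p)

  sameEdge-functional : ∀ {a c x y z} → a ≢ c → SameEdge a c x y → SameEdge a c x z → y ≡ z
  sameEdge-functional a≢c (inj₁ (_ , q)) (inj₁ (_ , q')) = trans q (sym q')
  sameEdge-functional a≢c (inj₁ (p , _)) (inj₂ (p' , _)) = ⊥-elim (a≢c (trans (sym p) p'))
  sameEdge-functional a≢c (inj₂ (p , _)) (inj₁ (p' , _)) = ⊥-elim (a≢c (trans (sym p') p))
  sameEdge-functional a≢c (inj₂ (_ , q)) (inj₂ (_ , q')) = trans q (sym q')

  sameEdge-endpoint : ∀ {a c x y} → SameEdge a c x y → (x ≡ a) ⊎ (x ≡ c)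
  sameEdge-endpoint (inj₁ (p , _)) = inj₁ p
  sameEdge-endpoint (inj₂ (p , _)) = inj₂ p

  otherEdgeAt : ∀ {u a z} → u ≢ a → z ≢ a → ¬ SameEdge u a u z
  otherEdgeAt u≢a z≢a (inj₁ (_ , p)) = z≢a p
  otherEdgeAt u≢a z≢a (inj₂ (p , _)) = u≢a p

  setEdge : PartialColouring → Fin n → Fin n → Maybe Palette → PartialColouring
  setEdge ψ a c v x y with sameEdge? a c x y
  ... | yes _ = v
  ... | no _ = ψ x y

  setEdge-cases : ∀ ψ a c v x y →
    (SameEdge a c x y × setEdge ψ a c v x y ≡ v) ⊎ (¬ SameEdge a c x y × setEdge ψ a c v x y ≡ ψ x y)
  setEdge-cases ψ a c v x y with sameEdge? a c x y
  ... | yes e = inj₁ (e , refl)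
  ... | no ¬e = inj₂ (¬e , refl)

  setEdge-on : ∀ ψ a c v x y → SameEdge a c x y → setEdge ψ a c v x y ≡ v
  setEdge-on ψ a c v x y e with setEdge-cases ψ a c v x y
  ... | inj₁ (_ , q) = q
  ... | inj₂ (¬e , _) = ⊥-elim (¬e e)

  setEdge-off : ∀ ψ a c v x y → ¬ SameEdge a c x y → setEdge ψ a c v x y ≡ ψ x y
  setEdge-off ψ a c v x y ¬e with setEdge-cases ψ a c v x y
  ... | inj₁ (e , _) = ⊥-elim (¬e e)
  ... | inj₂ (_ , q) = q

  setEdge-sym : ∀ ψ a c v → (∀ x y → ψ x y ≡ ψ y x) →
    ∀ x y → setEdge ψ a c v x y ≡ setEdge ψ a c v y x
  setEdge-sym ψ a c v ψ-sym x y with setEdge-cases ψ a c v x y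
  ... | inj₁ (e , q) = trans q (sym (setEdge-on ψ a c v y x (sameEdge-sym e)))
  ... | inj₂ (¬e , q) =
    trans q (trans (ψ-sym x y) (sym (setEdge-off ψ a c v y x (¬e ∘ sameEdge-sym))))

  uncolour-proper : ∀ ψ a c → ProperPartial ψ → ProperPartial (setEdge ψ a c nothing)
  uncolour-proper ψ a c ψ-proper = record
    { symmetric = setEdge-sym ψ a c nothing (symmetric ψ-proper) ; on-edges = edges ; proper = prop }
    where
    old : ∀ x y γ → setEdge ψ a c nothing x y ≡ just γ → ψ x y ≡ just γ
    old x y γ e with setEdge-cases ψ a c nothing x y
    ... | inj₁ (_ , q) = ⊥-elim (just≢nothing (trans (sym e) q))
    ... | inj₂ (_ , q) = trans (sym q) e
    edges : ∀ x y γ → setEdge ψ a c nothing x y ≡ just γ → Adj G x y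
    edges x y γ e = on-edges ψ-proper x y γ (old x y γ e)
    prop : ∀ x y z γ →
      setEdge ψ a c nothing x y ≡ just γ → setEdge ψ a c nothing x z ≡ just γ → y ≡ z
    prop x y z γ e e' = proper ψ-proper x y z γ (old x y γ e) (old x z γ e')

  colour-proper : ∀ ψ a c γ → ProperPartial ψ → Adj G a c → Misses ψ a γ → Misses ψ c γ →
    ProperPartial (setEdge ψ a c (just γ))
  colour-proper ψ a c γ ψ-proper ac a-misses c-misses = record
    { symmetric = setEdge-sym ψ a c (just γ) (symmetric ψ-proper) ; on-edges = edges ; proper = prop }
    where
    edges : ∀ x y δ → setEdge ψ a c (just γ) x y ≡ just δ → Adj G x y
    edges x y δ e with setEdge-cases ψ a c (just γ) x y
    ... | inj₁ (inj₁ (refl , refl) , _) = ac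
    ... | inj₁ (inj₂ (refl , refl) , _) = Graph.sym G ac
    ... | inj₂ (_ , q) = on-edges ψ-proper x y δ (trans (sym q) e)
    endMisses : ∀ x z → (x ≡ a) ⊎ (x ≡ c) → ψ x z ≢ just γ
    endMisses x z (inj₁ refl) = a-misses z
    endMisses x z (inj₂ refl) = c-misses z
    prop : ∀ x y z δ →
      setEdge ψ a c (just γ) x y ≡ just δ → setEdge ψ a c (just γ) x z ≡ just δ → y ≡ z
    prop x y z δ e e' with setEdge-cases ψ a c (just γ) x y | setEdge-cases ψ a c (just γ) x z
    ... | inj₁ (ey , _) | inj₁ (ez , _) = sameEdge-functional (adj-distinct ac) ey ez
    ... | inj₁ (ey , q) | inj₂ (_ , q') =
      ⊥-elim (endMisses x z (sameEdge-endpoint ey) (trans (sym q') (trans e' (trans (sym e) q))))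
    ... | inj₂ (_ , q) | inj₁ (ez , q') =
      ⊥-elim (endMisses x y (sameEdge-endpoint ez) (trans (sym q) (trans e (trans (sym e') q'))))
    ... | inj₂ (_ , q) | inj₂ (_ , q') = proper ψ-proper x y z δ (trans (sym q) e) (trans (sym q') e')

  uncolour-misses : ∀ ψ a c x δ → Misses ψ x δ → Misses (setEdge ψ a c nothing) x δ
  uncolour-misses ψ a c x δ x-misses y e with setEdge-cases ψ a c nothing x y
  ... | inj₁ (_ , q) = just≢nothing (trans (sym e) q)
  ... | inj₂ (_ , q) = x-misses y (trans (sym q) e)

  colour-misses-away : ∀ ψ a c γ x δ → x ≢ a → x ≢ c → Misses ψ x δ →
    Misses (setEdge ψ a c (just γ)) x δ
  colour-misses-away ψ a c γ x δ x≢a x≢c x-misses y e with setEdge-cases ψ a c (just γ) x y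
  ... | inj₁ (inj₁ (p , _) , _) = x≢a p
  ... | inj₁ (inj₂ (p , _) , _) = x≢c p
  ... | inj₂ (_ , q) = x-misses y (trans (sym q) e)

  colour-misses-other : ∀ ψ a c γ x δ → γ ≢ δ → Misses ψ x δ →
    Misses (setEdge ψ a c (just γ)) x δ
  colour-misses-other ψ a c γ x δ γ≢δ x-misses y e with setEdge-cases ψ a c (just γ) x y
  ... | inj₁ (_ , q) = γ≢δ (just-injective (trans (sym q) e))
  ... | inj₂ (_ , q) = x-misses y (trans (sym q) e)

  colour-extends : ∀ ψ a c γ → Extends ψ (setEdge ψ a c (just γ))
  colour-extends ψ a c γ x y coloured e with setEdge-cases ψ a c (just γ) x y
  ... | inj₁ (_ , q) = just≢nothing (trans (sym q) e)
  ... | inj₂ (_ , q) = coloured (trans (sym q) e)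

  colour-colours : ∀ ψ a c γ → setEdge ψ a c (just γ) a c ≢ nothing
  colour-colours ψ a c γ e =
    just≢nothing (trans (sym (setEdge-on ψ a c (just γ) a c (inj₁ (refl , refl)))) e)

  DistinctUpTo : (ℕ → Fin n) → ℕ → Set
  DistinctUpTo y r = ∀ a c → a < c → c ≤ r → y a ≢ y c

  -- Shifting the colours
  -- down the fan (u(y t) gets m t, for t ≤ r) colours u(y 0).
  rotateFan : ∀ r ψ → ProperPartial ψ → (u : Fin n) (y : ℕ → Fin n) (m : ℕ → Palette) →
    DistinctUpTo y r → (∀ t → t ≤ r → Adj G u (y t)) → ψ u (y 0) ≡ nothing →
    (∀ t → t ≤ r → Misses ψ (y t) (m t)) → (∀ t → t < r → ψ u (y (suc t)) ≡ just (m t)) →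
    Misses ψ u (m r) → Extension ψ u (y 0)
  rotateFan zero ψ ψ-proper u y m _ adj _ y-misses _ u-misses =
    setEdge ψ u (y 0) (just (m 0)) ,
    colour-proper ψ u (y 0) (m 0) ψ-proper (adj 0 z≤n) u-misses (y-misses 0 z≤n) ,
    colour-extends ψ u (y 0) (m 0) ,
    colour-colours ψ u (y 0) (m 0)
  rotateFan (suc r) ψ ψ-proper u y m distinct adj uy₀ y-misses fanEdge u-misses =
    shiftBack (rotateFan r ψ₂ ψ₂-proper u (y ∘ suc) (m ∘ suc)
      (λ a c a<c c≤r → distinct (suc a) (suc c) (s≤s a<c) (s≤s c≤r))
      (λ t t≤r → adj (suc t) (s≤s t≤r))
      uy₁-uncoloured
      (λ t t≤r → colour-misses-away ψ₁ u (y 0) (m 0) (y (suc t)) (m (suc t))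
          (λ p → adj-distinct (adj (suc t) (s≤s t≤r)) (sym p))
          (λ p → distinct 0 (suc t) (s≤s z≤n) (s≤s t≤r) (sym p))
          (uncolour-misses ψ u (y 1) (y (suc t)) (m (suc t)) (y-misses (suc t) (s≤s t≤r))))
      fanEdge₂
      (colour-misses-other ψ₁ u (y 0) (m 0) u (m (suc r)) m₀≢mᵣ
        (uncolour-misses ψ u (y 1) u (m (suc r)) u-misses)))
    where
    u≢y₀ : u ≢ y 0
    u≢y₀ = adj-distinct (adj 0 z≤n)
    u≢y₁ : u ≢ y 1
    u≢y₁ = adj-distinct (adj 1 (s≤s z≤n))
    y₁≢y₀ : y 1 ≢ y 0
    y₁≢y₀ p = distinct 0 1 (s≤s z≤n) (s≤s z≤n) (sym p)
    ψ₁ ψ₂ : PartialColouring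
    ψ₁ = setEdge ψ u (y 1) nothing
    ψ₂ = setEdge ψ₁ u (y 0) (just (m 0))
    u-misses-m₀ : Misses ψ₁ u (m 0)
    u-misses-m₀ z e with setEdge-cases ψ u (y 1) nothing u z
    ... | inj₁ (_ , q) = just≢nothing (trans (sym e) q)
    ... | inj₂ (¬e , q) =
      ¬e (inj₁ (refl , proper ψ-proper u z (y 1) (m 0) (trans (sym q) e) (fanEdge 0 (s≤s z≤n))))
    ψ₂-proper : ProperPartial ψ₂
    ψ₂-proper = colour-proper ψ₁ u (y 0) (m 0) (uncolour-proper ψ u (y 1) ψ-proper) (adj 0 z≤n)
      u-misses-m₀ (uncolour-misses ψ u (y 1) (y 0) (m 0) (y-misses 0 z≤n))
    uy₁-uncoloured : ψ₂ u (y 1) ≡ nothing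
    uy₁-uncoloured = trans (setEdge-off ψ₁ u (y 0) (just (m 0)) u (y 1) (otherEdgeAt u≢y₀ y₁≢y₀))
                           (setEdge-on ψ u (y 1) nothing u (y 1) (inj₁ (refl , refl)))
    fanEdge₂ : ∀ t → t < r → ψ₂ u (y (suc (suc t))) ≡ just (m (suc t))
    fanEdge₂ t t<r =
      trans (setEdge-off ψ₁ u (y 0) (just (m 0)) u (y (suc (suc t)))
              (otherEdgeAt u≢y₀ (λ p → distinct 0 (suc (suc t)) (s≤s z≤n) (s≤s t<r) (sym p))))
        (trans (setEdge-off ψ u (y 1) nothing u (y (suc (suc t)))
                 (otherEdgeAt u≢y₁
                   (λ p → distinct 1 (suc (suc t)) (s≤s (s≤s z≤n)) (s≤s t<r) (sym p))))
          (fanEdge (suc t) (s≤s t<r)))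
    m₀≢mᵣ : m 0 ≢ m (suc r)
    m₀≢mᵣ p = u-misses (y 1) (trans (fanEdge 0 (s≤s z≤n)) (cong just p))
    -- the recursive call recolours u(y 1), so the result extends ψ and colours u(y 0)
    shiftBack : Extension ψ₂ u (y 1) → Extension ψ u (y 0)
    shiftBack (ψ₃ , ψ₃-proper , ext₃ , uy₁) =
      ψ₃ , ψ₃-proper , ext , ext₃ u (y 0) (colour-colours ψ₁ u (y 0) (m 0))
      where
      ext : Extends ψ ψ₃
      ext x z coloured with sameEdge? u (y 1) x z
      ... | yes (inj₁ (refl , refl)) = uy₁
      ... | yes (inj₂ (refl , refl)) = λ e → uy₁ (trans (symmetric ψ₃-proper u (y 1)) e)
      ... | no ¬e = ext₃ x z (colour-extends ψ₁ u (y 0) (m 0) x z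
                     (λ e → coloured (trans (sym (setEdge-off ψ u (y 1) nothing x z ¬e)) e)))

  partner : PartialColouring → Fin n → Palette → Maybe (Fin n)
  partner ψ x γ with any? (λ y → ψ x y ≟ₘ just γ)
  ... | yes (y , _) = just y
  ... | no _ = nothing

  partner-cases : ∀ ψ x γ →
    (Σ (Fin n) λ y → partner ψ x γ ≡ just y × ψ x y ≡ just γ) ⊎
    (partner ψ x γ ≡ nothing × Misses ψ x γ)
  partner-cases ψ x γ with any? (λ y → ψ x y ≟ₘ just γ)
  ... | yes (y , e) = inj₁ (y , refl , e)
  ... | no none = inj₂ (refl , λ y e → none (y , e))

  partner-of : ∀ {ψ} → ProperPartial ψ → ∀ x y γ → ψ x y ≡ just γ → partner ψ x γ ≡ just y
  partner-of {ψ} ψ-proper x y γ e with partner-cases ψ x γ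
  ... | inj₁ (y' , q , e') = trans q (cong just (proper ψ-proper x y' y γ e' e))
  ... | inj₂ (_ , x-misses) = ⊥-elim (x-misses y e)

  -- The chain is the walk from u that alternately
  -- follows edges of colour d and c; it is a path, it ends at the second vertex of degree at
  -- most one in the (c,d)-subgraph, and exchanging c and d on the edges at its vertices keeps
  -- the colouring proper and makes d missing at u.
  module KempeChain (ψ : PartialColouring) (ψ-proper : ProperPartial ψ) (u : Fin n) (c d : Palette)
                    (c≢d : c ≢ d) (u-misses-c : Misses ψ u c) where

    even : ℕ → Bool
    even zero = true
    even (suc t) = not (even t)

    chainColour : ℕ → Palette
    chainColour t = if even t then d else c

    chainColour-parity : ∀ t t' → even t ≡ even t' → chainColour t ≡ chainColour t'
    chainColour-parity t t' e = cong (λ p → if p then d else c) e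

    chainColour-alternates : ∀ t → chainColour (suc t) ≢ chainColour t
    chainColour-alternates t e with even t
    ... | true = c≢d e
    ... | false = c≢d (sym e)

    chainColour-other : ∀ t γ → (γ ≡ c) ⊎ (γ ≡ d) → γ ≢ chainColour (suc t) →
      γ ≡ chainColour t
    chainColour-other t γ γ∈cd γ≢ with even t
    chainColour-other t γ (inj₁ e) γ≢ | true = ⊥-elim (γ≢ e)
    chainColour-other t γ (inj₂ e) γ≢ | true = e
    chainColour-other t γ (inj₁ e) γ≢ | false = e
    chainColour-other t γ (inj₂ e) γ≢ | false = ⊥-elim (γ≢ e)

    step : ℕ → Maybe (Fin n) → Maybe (Fin n)
    step t nothing = nothing
    step t (just x) = partner ψ x (chainColour t)

    walk : ℕ → Maybe (Fin n)
    walk zero = just u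
    walk (suc t) = step t (walk t)

    walk-back : ∀ t y → walk (suc t) ≡ just y →
      Σ (Fin n) λ x → walk t ≡ just x × ψ x y ≡ just (chainColour t)
    walk-back t y e with walk t
    ... | nothing = ⊥-elim (just≢nothing (sym e))
    ... | just x with partner-cases ψ x (chainColour t)
    ...   | inj₁ (y' , q , e') =
      x , refl , subst (λ z → ψ x z ≡ just (chainColour t)) (just-injective (trans (sym q) e)) e'
    ...   | inj₂ (q , _) = ⊥-elim (just≢nothing (trans (sym e) q))

    walk-forward : ∀ t x y → walk t ≡ just x → ψ x y ≡ just (chainColour t) → walk (suc t) ≡ just y
    walk-forward t x y e e' = trans (cong (step t) e) (partner-of ψ-proper x y (chainColour t) e')

    walk-stops : ∀ t x → walk t ≡ just x → Misses ψ x (chainColour t) → walk (suc t) ≡ nothing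
    walk-stops t x e x-misses with partner-cases ψ x (chainColour t)
    ... | inj₁ (y , _ , e') = ⊥-elim (x-misses y e')
    ... | inj₂ (q , _) = trans (cong (step t) e) q

    walk-ended : ∀ {t t'} → t ≤′ t' → walk t ≡ nothing → walk t' ≡ nothing
    walk-ended ≤′-refl e = e
    walk-ended (≤′-step t≤t') e = cong (step _) (walk-ended t≤t' e)

    walk-defined-below : ∀ {t t'} → t ≤ t' → walk t' ≢ nothing → walk t ≢ nothing
    walk-defined-below t≤t' defined e = defined (walk-ended (≤⇒≤′ t≤t') e)

    ψ-irrefl : ∀ x γ → ψ x x ≢ just γ
    ψ-irrefl x γ e = irrefl G (on-edges ψ-proper x x γ e)

    Fresh : ℕ → Set
    Fresh j = ∀ i a → i < j → walk i ≡ just a → walk j ≡ just a → ⊥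

    even-at-start : ∀ j x → ψ u x ≡ just (chainColour j) → even j ≡ true
    even-at-start j x e with even j
    ... | true = refl
    ... | false = ⊥-elim (u-misses-c x e)

    -- The walk cannot return to u: it would enter u along the d-edge, i.e. from walk 1.
    not-back-to-start : ∀ j x → Fresh j → walk j ≡ just x → ψ u x ≡ just (chainColour j) → ⊥
    not-back-to-start zero x _ wj ux =
      ψ-irrefl u (chainColour 0) (subst (λ z → ψ u z ≡ just (chainColour 0)) (sym (just-injective wj)) ux)
    not-back-to-start (suc zero) x _ _ ux with even-at-start 1 x ux
    ... | ()
    not-back-to-start (suc (suc j)) x fresh wj ux =
      fresh 1 x (s≤s (s≤s z≤n))
        (walk-forward 0 u x refl
          (trans ux (cong just (chainColour-parity (suc (suc j)) 0 (even-at-start (suc (suc j)) x ux)))))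
        wj

    -- The walk cannot return to an interior vertex a = walk (suc i), i < j: the only chain
    -- edges at a lead to walk i and walk (i+2), so walk j would be one of them, contradicting
    -- freshness of walk j (or alternation of colours, or irreflexivity, if j ≤ i + 2).
    not-back-to-interior : ∀ i j a x → Fresh j → suc i ≤ j → walk (suc i) ≡ just a →
      walk j ≡ just x → ψ x a ≡ just (chainColour j) → walk (suc j) ≡ just a → ⊥
    not-back-to-interior i j a x fresh i<j wa wj xa wa'
      with walk-back i a wa
         | justWitness (walk (suc (suc i)))
             (walk-defined-below (s≤s i<j) (λ e → just≢nothing (trans (sym wa') e)))
    ... | x₀ , wx₀ , x₀a | x₂ , wx₂ with walk-back (suc i) x₂ wx₂
    ... | a' , wa'' , ax₂ with just-injective (trans (sym wa'') wa)
    ... | refl with even j ≟ᵇ even i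
    ... | yes same = fresh i x₀ i<j wx₀ (trans wj (cong just x≡x₀))
      where
      x≡x₀ : x ≡ x₀
      x≡x₀ = proper ψ-proper a' x x₀ (chainColour j) (trans (symmetric ψ-proper a' x) xa)
               (trans (symmetric ψ-proper a' x₀) (trans x₀a (cong just (sym (chainColour-parity j i same)))))
    ... | no different = compare (<-cmp (suc (suc i)) j)
      where
      x≡x₂ : x ≡ x₂
      x≡x₂ = proper ψ-proper a' x x₂ (chainColour j) (trans (symmetric ψ-proper a' x) xa)
               (trans ax₂ (cong just (sym (chainColour-parity j (suc i) (¬-not different)))))
      compare : Tri (suc (suc i) < j) (suc (suc i) ≡ j) (j < suc (suc i)) → ⊥
      compare (tri< lt _ _) = fresh (suc (suc i)) x₂ lt wx₂ (trans wj (cong just x≡x₂))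
      compare (tri≈ _ refl _) =
        chainColour-alternates (suc i) (chainColour-parity (suc (suc i)) (suc i) (¬-not different))
      compare (tri> _ _ gt) with ≤-antisym i<j (s≤s⁻¹ gt)
      ... | refl = ψ-irrefl x (chainColour j)
                     (subst (λ z → ψ x z ≡ just (chainColour j)) (sym (just-injective (trans (sym wj) wa))) xa)

    walk-fresh : ∀ j → Fresh j
    walk-fresh (suc j) i a i<j wi wj with walk-back j a wj
    ... | x , wx , xa = earlier i i<j wi
      where
      earlier : ∀ i → i < suc j → walk i ≡ just a → ⊥
      earlier zero _ wu = not-back-to-start j x (walk-fresh j) wx
        (trans (cong (λ z → ψ z x) (just-injective wu)) (trans (symmetric ψ-proper a x) xa))
      earlier (suc i) i<j wi = not-back-to-interior i j a x (walk-fresh j) (s≤s⁻¹ i<j) wi wx xa wj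

    -- A walk without repetitions in Fin n has ended after n steps.
    walk-ends : walk n ≡ nothing
    walk-ends with walk n in eq
    ... | nothing = refl
    ... | just _ = ⊥-elim (tooLong (λ e → just≢nothing (trans (sym eq) e)))
      where
      tooLong : walk n ≢ nothing → ⊥
      tooLong defined = case pigeonhole (n<1+n n) vertexAt of λ where
          (i , j , i<j , same) → walk-fresh (toℕ j) (toℕ i) (vertexAt i) i<j (vertexAt-spec i)
                                   (trans (vertexAt-spec j) (cong just (sym same)))
        where
        definedAt : (t : Fin (suc n)) → walk (toℕ t) ≢ nothing
        definedAt t = walk-defined-below (s≤s⁻¹ (toℕ<n t)) defined
        vertexAt : Fin (suc n) → Fin n
        vertexAt t = proj₁ (justWitness _ (definedAt t))
        vertexAt-spec : ∀ t → walk (toℕ t) ≡ just (vertexAt t)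
        vertexAt-spec t = proj₂ (justWitness _ (definedAt t))

    OnChain : Fin n → Set
    OnChain x = Σ (Fin n) λ t → walk (toℕ t) ≡ just x

    onChain? : ∀ x → Dec (OnChain x)
    onChain? x = any? (λ t → ≡-decMaybe _≟_ (walk (toℕ t)) (just x))

    onChain : ∀ t x → walk t ≡ just x → OnChain x
    onChain t x e with t <ℕ? n
    ... | yes t<n = fromℕ< t<n , trans (cong walk (toℕ-fromℕ< t<n)) e
    ... | no t≮n =
      ⊥-elim (just≢nothing (trans (sym e) (walk-ended (≤⇒≤′ (≮⇒≥ t≮n)) walk-ends)))

    start-onChain : OnChain u
    start-onChain = onChain 0 u refl

    chain-closed : ∀ {x y γ} → OnChain x → ψ x y ≡ just γ → (γ ≡ c) ⊎ (γ ≡ d) → OnChain y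
    chain-closed {x} {y} {γ} (t , wt) = closed (toℕ t) wt
      where
      closed : ∀ t → walk t ≡ just x → ψ x y ≡ just γ → (γ ≡ c) ⊎ (γ ≡ d) → OnChain y
      closed t wt xy γ∈cd with γ ≟ chainColour t
      ... | yes forward = onChain (suc t) y (walk-forward t x y wt (trans xy (cong just forward)))
      closed zero wt xy (inj₁ refl) | no _ =
        ⊥-elim (u-misses-c y (subst (λ z → ψ z y ≡ just c) (sym (just-injective wt)) xy))
      closed zero wt xy (inj₂ refl) | no γ≢d = ⊥-elim (γ≢d refl)
      closed (suc t) wt xy γ∈cd | no γ≢ with walk-back t x wt
      ... | x₀ , wx₀ , x₀x = onChain t y (trans wx₀ (cong just (sym y≡x₀)))
        where
        y≡x₀ : y ≡ x₀
        y≡x₀ = proper ψ-proper x y x₀ γ xy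
                 (trans (symmetric ψ-proper x x₀)
                   (trans x₀x (cong just (sym (chainColour-other t γ γ∈cd γ≢)))))

    chain-end : ∀ t x → walk t ≡ just x → x ≢ u → Misses ψ x d → walk (suc t) ≡ nothing
    chain-end zero x e x≢u _ = ⊥-elim (x≢u (sym (just-injective e)))
    chain-end (suc t) x e _ x-misses-d with walk-back t x e
    ... | x₀ , _ , x₀x = walk-stops (suc t) x e (subst (Misses ψ x) (sym arrivedByC) x-misses-d)
      where
      arrivedByC : chainColour (suc t) ≡ d
      arrivedByC with even t
      ... | false = refl
      ... | true = ⊥-elim (x-misses-d x₀ (trans (symmetric ψ-proper x x₀) x₀x))

    chain-end-unique : ∀ x x' → OnChain x → x ≢ u → Misses ψ x d →
      OnChain x' → x' ≢ u → Misses ψ x' d → x ≡ x'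
    chain-end-unique x x' (t , wt) x≢u x-misses (t' , wt') x'≢u x'-misses with <-cmp (toℕ t) (toℕ t')
    ... | tri< lt _ _ =
      ⊥-elim (just≢nothing (trans (sym wt') (walk-ended (≤⇒≤′ lt) (chain-end (toℕ t) x wt x≢u x-misses))))
    ... | tri≈ _ e _ = just-injective (trans (sym wt) (trans (cong walk e) wt'))
    ... | tri> _ _ gt =
      ⊥-elim (just≢nothing (trans (sym wt) (walk-ended (≤⇒≤′ gt) (chain-end (toℕ t') x' wt' x'≢u x'-misses))))

    swap : Palette → Palette
    swap γ with γ ≟ c | γ ≟ d
    ... | yes _ | _ = d
    ... | no _ | yes _ = c
    ... | no _ | no _ = γ

    swap-c : swap c ≡ d
    swap-c with c ≟ c
    ... | yes _ = refl
    ... | no c≢c = ⊥-elim (c≢c refl)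

    swap-d : swap d ≡ c
    swap-d with d ≟ c | d ≟ d
    ... | yes d≡c | _ = ⊥-elim (c≢d (sym d≡c))
    ... | no _ | yes _ = refl
    ... | no _ | no d≢d = ⊥-elim (d≢d refl)

    swap-other : ∀ γ → γ ≢ c → γ ≢ d → swap γ ≡ γ
    swap-other γ γ≢c γ≢d with γ ≟ c | γ ≟ d
    ... | yes e | _ = ⊥-elim (γ≢c e)
    ... | no _ | yes e = ⊥-elim (γ≢d e)
    ... | no _ | no _ = refl

    swap-involutive : ∀ γ → swap (swap γ) ≡ γ
    swap-involutive γ = byCases (γ ≟ c) (γ ≟ d)
      where
      byCases : Dec (γ ≡ c) → Dec (γ ≡ d) → swap (swap γ) ≡ γ
      byCases (yes refl) _ = trans (cong swap swap-c) swap-d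
      byCases (no _) (yes refl) = trans (cong swap swap-d) swap-c
      byCases (no γ≢c) (no γ≢d) =
        trans (cong swap (swap-other γ γ≢c γ≢d)) (swap-other γ γ≢c γ≢d)

    swapped : PartialColouring
    swapped x y with onChain? x
    ... | yes _ = mapMaybe swap (ψ x y)
    ... | no _ = ψ x y

    swapped-cases : ∀ x y →
      (OnChain x × swapped x y ≡ mapMaybe swap (ψ x y)) ⊎ (¬ OnChain x × swapped x y ≡ ψ x y)
    swapped-cases x y with onChain? x
    ... | yes on = inj₁ (on , refl)
    ... | no off = inj₂ (off , refl)

    swapped-back : ∀ x y γ → swapped x y ≡ just γ →
      (OnChain x × ψ x y ≡ just (swap γ)) ⊎ (¬ OnChain x × ψ x y ≡ just γ)
    swapped-back x y γ e with swapped-cases x y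
    ... | inj₂ (off , q) = inj₂ (off , trans (sym q) e)
    ... | inj₁ (on , q) with ψ x y
    ...   | just δ =
      inj₁ (on , cong just (trans (sym (swap-involutive δ)) (cong swap (just-injective (trans (sym q) e)))))
    ...   | nothing = ⊥-elim (just≢nothing (trans (sym e) q))

    -- An edge from the chain to outside it has a colour other than c and d.
    swap-leaving : ∀ x y → OnChain x → ¬ OnChain y → mapMaybe swap (ψ x y) ≡ ψ x y
    swap-leaving x y on off with ψ x y in eq
    ... | nothing = refl
    ... | just γ = cong just (swap-other γ (λ γ≡c → off (chain-closed on eq (inj₁ γ≡c)))
                                           (λ γ≡d → off (chain-closed on eq (inj₂ γ≡d))))

    swapped-proper : ProperPartial swapped
    swapped-proper = record { symmetric = sym' ; on-edges = edges ; proper = prop }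
      where
      ψ-sym : ∀ x y → ψ x y ≡ ψ y x
      ψ-sym = symmetric ψ-proper
      sym' : ∀ x y → swapped x y ≡ swapped y x
      sym' x y with swapped-cases x y | swapped-cases y x
      ... | inj₁ (_ , q) | inj₁ (_ , q') = trans q (trans (cong (mapMaybe swap) (ψ-sym x y)) (sym q'))
      ... | inj₁ (on , q) | inj₂ (off , q') =
        trans q (trans (swap-leaving x y on off) (trans (ψ-sym x y) (sym q')))
      ... | inj₂ (off , q) | inj₁ (on , q') =
        trans q (trans (ψ-sym x y) (trans (sym (swap-leaving y x on off)) (sym q')))
      ... | inj₂ (_ , q) | inj₂ (_ , q') = trans q (trans (ψ-sym x y) (sym q'))
      edges : ∀ x y γ → swapped x y ≡ just γ → Adj G x y
      edges x y γ e with swapped-back x y γ e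
      ... | inj₁ (_ , q) = on-edges ψ-proper x y _ q
      ... | inj₂ (_ , q) = on-edges ψ-proper x y _ q
      prop : ∀ x y z γ → swapped x y ≡ just γ → swapped x z ≡ just γ → y ≡ z
      prop x y z γ e e' with swapped-back x y γ e | swapped-back x z γ e'
      ... | inj₁ (_ , q) | inj₁ (_ , q') = proper ψ-proper x y z _ q q'
      ... | inj₁ (on , _) | inj₂ (off , _) = ⊥-elim (off on)
      ... | inj₂ (off , _) | inj₁ (on , _) = ⊥-elim (off on)
      ... | inj₂ (_ , q) | inj₂ (_ , q') = proper ψ-proper x y z _ q q'

    swapped-extends : Extends ψ swapped
    swapped-extends x y coloured e with swapped-cases x y
    ... | inj₂ (_ , q) = coloured (trans (sym q) e)
    ... | inj₁ (_ , q) with ψ x y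
    ...   | nothing = coloured refl
    ...   | just γ = just≢nothing (trans (sym q) e)

    swapped-uncoloured : ∀ x y → ψ x y ≡ nothing → swapped x y ≡ nothing
    swapped-uncoloured x y e with swapped-cases x y
    ... | inj₁ (_ , q) = trans q (cong (mapMaybe swap) e)
    ... | inj₂ (_ , q) = trans q e

    swapped-misses-other : ∀ x γ → γ ≢ c → γ ≢ d → Misses ψ x γ → Misses swapped x γ
    swapped-misses-other x γ γ≢c γ≢d x-misses y e with swapped-back x y γ e
    ... | inj₁ (_ , q) = x-misses y (trans q (cong just (swap-other γ γ≢c γ≢d)))
    ... | inj₂ (_ , q) = x-misses y q

    swapped-edge-other : ∀ x y γ → γ ≢ c → γ ≢ d → ψ x y ≡ just γ → swapped x y ≡ just γ
    swapped-edge-other x y γ γ≢c γ≢d e with swapped-cases x y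
    ... | inj₁ (_ , q) = trans q (trans (cong (mapMaybe swap) e) (cong just (swap-other γ γ≢c γ≢d)))
    ... | inj₂ (_ , q) = trans q e

    swapped-misses-off : ∀ x γ → ¬ OnChain x → Misses ψ x γ → Misses swapped x γ
    swapped-misses-off x γ off x-misses y e with swapped-back x y γ e
    ... | inj₁ (on , _) = off on
    ... | inj₂ (_ , q) = x-misses y q

    swapped-misses-on : ∀ x γ → OnChain x → Misses ψ x γ → Misses swapped x (swap γ)
    swapped-misses-on x γ on x-misses y e with swapped-back x y (swap γ) e
    ... | inj₁ (_ , q) = x-misses y (trans q (cong just (swap-involutive γ)))
    ... | inj₂ (off , _) = off on

    swapped-edge-on : ∀ x y γ → OnChain x → ψ x y ≡ just γ → swapped x y ≡ just (swap γ)
    swapped-edge-on x y γ on e with swapped-cases x y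
    ... | inj₁ (_ , q) = trans q (cong (mapMaybe swap) e)
    ... | inj₂ (off , _) = ⊥-elim (off on)

    swapped-u-misses-d : Misses swapped u d
    swapped-u-misses-d = subst (Misses swapped u) swap-c (swapped-misses-on u c start-onChain u-misses-c)

  module ColourOneEdge (ψ : PartialColouring) (ψ-proper : ProperPartial ψ) (u v₀ : Fin n)
                       (uv₀ : Adj G u v₀) (uv₀-uncoloured : ψ u v₀ ≡ nothing) where

    missing : Fin n → Palette
    missing x = proj₁ (missingColour ψ-proper x)

    misses-missing : ∀ x → Misses ψ x (missing x)
    misses-missing x = proj₂ (missingColour ψ-proper x)

    -- The fan at u: fan (t+1) is the neighbour of u along the colour missing at fan t
    -- (meaningful as long as that colour is present at u).
    fan : ℕ → Fin n
    fan zero = v₀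
    fan (suc t) = fromMaybe (fan t) (partner ψ u (missing (fan t)))

    fan-step : ∀ t → ¬ Misses ψ u (missing (fan t)) → ψ u (fan (suc t)) ≡ just (missing (fan t))
    fan-step t present with partner-cases ψ u (missing (fan t))
    ... | inj₁ (z , q , e) =
      subst (λ w → ψ u w ≡ just (missing (fan t))) (sym (cong (fromMaybe (fan t)) q)) e
    ... | inj₂ (_ , absent) = ⊥-elim (present absent)

    Stops : ℕ → Set
    Stops t = Misses ψ u (missing (fan t)) ⊎ (∃ λ s → s < t × missing (fan s) ≡ missing (fan t))

    stops? : ∀ t → Dec (Stops t)
    stops? t = misses? ψ u (missing (fan t)) ⊎-dec anyUpTo? (λ s → missing (fan s) ≟ missing (fan t)) t

    module FanUpTo (T : ℕ) (running : ∀ t → t < T → ¬ Stops t) where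

      fan-edge : ∀ t → t < T → ψ u (fan (suc t)) ≡ just (missing (fan t))
      fan-edge t t<T = fan-step t (λ absent → running t t<T (inj₁ absent))

      fan-distinct : DistinctUpTo fan T
      fan-distinct a (suc c) a<c c<T same = earlier a a<c same
        where
        uc : ψ u (fan (suc c)) ≡ just (missing (fan c))
        uc = fan-edge c c<T
        earlier : ∀ a → a < suc c → fan a ≡ fan (suc c) → ⊥
        earlier zero _ same = just≢nothing (trans (sym uc) (trans (cong (ψ u) (sym same)) uv₀-uncoloured))
        earlier (suc a) a<c same = running c c<T (inj₂ (a , s≤s⁻¹ a<c ,
          just-injective (trans (sym (fan-edge a (<-trans (s≤s⁻¹ a<c) c<T))) (trans (cong (ψ u) same) uc))))

      fan-distinct' : ∀ a c → a ≢ c → a ≤ T → c ≤ T → fan a ≢ fan c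
      fan-distinct' a c a≢c a≤T c≤T with <-cmp a c
      ... | tri< a<c _ _ = fan-distinct a c a<c c≤T
      ... | tri≈ _ a≡c _ = ⊥-elim (a≢c a≡c)
      ... | tri> _ _ c<a = λ same → fan-distinct c a c<a a≤T (sym same)

      fan-adj : ∀ t → t ≤ T → Adj G u (fan t)
      fan-adj zero _ = uv₀
      fan-adj (suc t) t<T = on-edges ψ-proper u (fan (suc t)) _ (fan-edge t t<T)

      fan-not-u : ∀ t → t ≤ T → fan t ≢ u
      fan-not-u t t≤T same = adj-distinct (fan-adj t t≤T) (sym same)

    -- n + 1 distinct vertices do not exist, so the fan stops within n steps.
    fan-stops : ¬ (∀ t → t < suc n → ¬ Stops t)
    fan-stops running with pigeonhole (n<1+n n) (fan ∘ toℕ)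
    ... | i , j , i<j , same =
      FanUpTo.fan-distinct n (λ t t<n → running t (m<n⇒m<1+n t<n))
        (toℕ i) (toℕ j) i<j (s≤s⁻¹ (toℕ<n j)) same

    -- Write y for fan.  The fan y 0 … y t stops because d, the colour missing at y t, was
    -- already missing at y s for some s < t; so u(y (s+1)) has colour d.  Exchange c (missing
    -- at u) and d along the Kempe chain from u; afterwards d is missing at u.  Both y s and y t
    -- miss d, so the chain ends at most at one of them.  If y s is off the chain, rotate the fan
    -- y 0 … y s; otherwise y t is off the chain, and we rotate y 0 … y t, using that u(y (s+1))
    -- now has colour c, which is missing at y s.
    module RepeatedColour (t : ℕ) (running : ∀ t' → t' < t → ¬ Stops t') (s : ℕ) (s<t : s < t)
                          (repeated : missing (fan s) ≡ missing (fan t)) where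
      open FanUpTo t running

      c d : Palette
      c = missing u
      d = missing (fan t)

      us₁-d : ψ u (fan (suc s)) ≡ just d
      us₁-d = trans (fan-edge s s<t) (cong just repeated)

      c≢d : c ≢ d
      c≢d c≡d = misses-missing u (fan (suc s)) (trans us₁-d (cong just (sym c≡d)))

      open KempeChain ψ ψ-proper u c d c≢d (misses-missing u)

      fan-colour-not-c : ∀ t' → t' < t → missing (fan t') ≢ c
      fan-colour-not-c t' t'<t e = misses-missing u (fan (suc t')) (trans (fan-edge t' t'<t) (cong just e))

      fan-colour-not-d : ∀ t' → t' < t → t' ≢ s → missing (fan t') ≢ d
      fan-colour-not-d t' t'<t t'≢s e =
        fan-distinct' (suc t') (suc s) (t'≢s ∘ suc-injective) t'<t s<t
          (proper ψ-proper u (fan (suc t')) (fan (suc s)) d (trans (fan-edge t' t'<t) (cong just e)) us₁-d)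

      ys-misses-d : Misses ψ (fan s) d
      ys-misses-d = subst (Misses ψ (fan s)) repeated (misses-missing (fan s))

      fan-uncoloured : swapped u (fan 0) ≡ nothing
      fan-uncoloured = swapped-uncoloured u v₀ uv₀-uncoloured

      fan-edge-kept : ∀ t' → t' < t → t' ≢ s → swapped u (fan (suc t')) ≡ just (missing (fan t'))
      fan-edge-kept t' t'<t t'≢s = swapped-edge-other u (fan (suc t')) (missing (fan t'))
        (fan-colour-not-c t' t'<t) (fan-colour-not-d t' t'<t t'≢s) (fan-edge t' t'<t)

      shortFan : ¬ OnChain (fan s) → Extension ψ u v₀
      shortFan off = extension-after swapped-extends
        (rotateFan s swapped swapped-proper u fan (missing ∘ fan)
          (λ a c a<c c≤s → fan-distinct a c a<c (≤-trans c≤s (<⇒≤ s<t)))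
          (λ t' t'≤s → fan-adj t' (≤-trans t'≤s (<⇒≤ s<t)))
          fan-uncoloured misses edges (subst (Misses swapped u) (sym repeated) swapped-u-misses-d))
        where
        misses : ∀ t' → t' ≤ s → Misses swapped (fan t') (missing (fan t'))
        misses t' t'≤s with t' ≟ℕ s
        ... | yes refl = swapped-misses-off (fan s) _ off (misses-missing (fan s))
        ... | no t'≢s = swapped-misses-other (fan t') _ (fan-colour-not-c t' t'<t)
                          (fan-colour-not-d t' t'<t t'≢s) (misses-missing (fan t'))
          where
          t'<t : t' < t
          t'<t = ≤-<-trans t'≤s s<t
        edges : ∀ t' → t' < s → swapped u (fan (suc t')) ≡ just (missing (fan t'))
        edges t' t'<s = fan-edge-kept t' (<-trans t'<s s<t) (<⇒≢ t'<s)

      fanColour : ℕ → Palette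
      fanColour t' with t' ≟ℕ s
      ... | yes _ = c
      ... | no _ = missing (fan t')

      fanColour-s : fanColour s ≡ c
      fanColour-s with s ≟ℕ s
      ... | yes _ = refl
      ... | no s≢s = ⊥-elim (s≢s refl)

      fanColour-other : ∀ t' → t' ≢ s → fanColour t' ≡ missing (fan t')
      fanColour-other t' t'≢s with t' ≟ℕ s
      ... | yes t'≡s = ⊥-elim (t'≢s t'≡s)
      ... | no _ = refl

      longFan : OnChain (fan s) → Extension ψ u v₀
      longFan on = extension-after swapped-extends
        (rotateFan t swapped swapped-proper u fan fanColour fan-distinct fan-adj fan-uncoloured
          misses edges
          (subst (Misses swapped u) (sym (fanColour-other t (<⇒≢ s<t ∘ sym))) swapped-u-misses-d))
        where
        yt-off : ¬ OnChain (fan t)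
        yt-off on-t = fan-distinct s t s<t ≤-refl
          (chain-end-unique (fan s) (fan t) on (fan-not-u s (<⇒≤ s<t)) ys-misses-d
                            on-t (fan-not-u t ≤-refl) (misses-missing (fan t)))
        misses : ∀ t' → t' ≤ t → Misses swapped (fan t') (fanColour t')
        misses t' t'≤t = byCases (t' ≟ℕ s) (<-cmp t' t)
          where
          byCases : Dec (t' ≡ s) → Tri (t' < t) (t' ≡ t) (t < t') → Misses swapped (fan t') (fanColour t')
          byCases (yes refl) _ = subst (Misses swapped (fan s)) (trans swap-d (sym fanColour-s))
                                   (swapped-misses-on (fan s) d on ys-misses-d)
          byCases (no t'≢s) (tri< t'<t _ _) =
            subst (Misses swapped (fan t')) (sym (fanColour-other t' t'≢s))
              (swapped-misses-other (fan t') _ (fan-colour-not-c t' t'<t) (fan-colour-not-d t' t'<t t'≢s)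
                (misses-missing (fan t')))
          byCases (no t'≢s) (tri≈ _ refl _) = subst (Misses swapped (fan t)) (sym (fanColour-other t t'≢s))
                                                (swapped-misses-off (fan t) d yt-off (misses-missing (fan t)))
          byCases (no _) (tri> _ _ t<t') = ⊥-elim (<-irrefl refl (≤-<-trans t'≤t t<t'))
        edges : ∀ t' → t' < t → swapped u (fan (suc t')) ≡ just (fanColour t')
        edges t' t'<t = byCases (t' ≟ℕ s)
          where
          byCases : Dec (t' ≡ s) → swapped u (fan (suc t')) ≡ just (fanColour t')
          byCases (yes refl) = trans (swapped-edge-on u (fan (suc s)) d start-onChain us₁-d)
                                     (cong just (trans swap-d (sym fanColour-s)))
          byCases (no t'≢s) = trans (fan-edge-kept t' t'<t t'≢s) (cong just (sym (fanColour-other t' t'≢s)))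

      extension : Extension ψ u v₀
      extension with onChain? (fan s)
      ... | no off = shortFan off
      ... | yes on = longFan on

    extension : Extension ψ u v₀
    extension with leastBelow Stops stops? (suc n)
    ... | inj₂ running = ⊥-elim (fan-stops running)
    ... | inj₁ (t , _ , inj₁ u-misses , running) =
      rotateFan t ψ ψ-proper u fan (missing ∘ fan) fan-distinct fan-adj uv₀-uncoloured
        (λ t' _ → misses-missing (fan t')) fan-edge u-misses
      where open FanUpTo t running
    ... | inj₁ (t , _ , inj₂ (s , s<t , repeated) , running) =
      RepeatedColour.extension t running s s<t repeated

  colourIfEdge : ∀ ψ → ProperPartial ψ → ∀ a c →
    Σ PartialColouring λ ψ' → ProperPartial ψ' × Extends ψ ψ' × (Adj G a c → ψ' a c ≢ nothing)
  colourIfEdge ψ ψ-proper a c with Adj? a c | ψ a c ≟ₘ nothing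
  ... | yes ac | yes uncoloured =
    let ψ' , ψ'-proper , ext , coloured = ColourOneEdge.extension ψ ψ-proper a c ac uncoloured
    in ψ' , ψ'-proper , ext , λ _ → coloured
  ... | yes _ | no coloured = ψ , ψ-proper , (λ _ _ coloured' → coloured') , λ _ → coloured
  ... | no ¬ac | _ = ψ , ψ-proper , (λ _ _ coloured' → coloured') , λ ac → ⊥-elim (¬ac ac)

  colourAll : (ps : List (Fin n × Fin n)) → ∀ ψ → ProperPartial ψ →
    Σ PartialColouring λ ψ' → ProperPartial ψ' ×
      (∀ {x y} → (x , y) ∈ ps → Adj G x y → ψ' x y ≢ nothing)
  colourAll [] ψ ψ-proper = ψ , ψ-proper , λ ()
  colourAll ((a , c) ∷ ps) ψ ψ-proper =
    let ψ₁ , ψ₁-proper , done = colourAll ps ψ ψ-proper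
        ψ₂ , ψ₂-proper , ext , ac-coloured = colourIfEdge ψ₁ ψ₁-proper a c
    in ψ₂ , ψ₂-proper , λ { (here refl) → ac-coloured ; (there p) xy → ext _ _ (done p xy) }

  vizing : ProperEdgeColouring G (suc b)
  vizing = record { colour = colour ; colour-sym = colour-sym ; colour-proper = colour-proper' }
    where
    complete : Σ PartialColouring λ ψ → ProperPartial ψ ×
      (∀ {x y} → (x , y) ∈ cartesianProduct (allFin n) (allFin n) → Adj G x y → ψ x y ≢ nothing)
    complete = colourAll (cartesianProduct (allFin n) (allFin n)) (λ _ _ → nothing) empty-proper
    ψ : PartialColouring
    ψ = proj₁ complete
    ψ-proper : ProperPartial ψ
    ψ-proper = proj₁ (proj₂ complete)
    coloured : ∀ {x y} → Adj G x y → ψ x y ≢ nothing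
    coloured {x} {y} = proj₂ (proj₂ complete) (∈-cartesianProduct⁺ (∈-allFin x) (∈-allFin y))
    colour : Fin n → Fin n → Palette
    colour x y = fromMaybe fzero (ψ x y)
    colour-sym : ∀ x y → colour x y ≡ colour y x
    colour-sym x y = cong (fromMaybe fzero) (symmetric ψ-proper x y)
    colour-proper' : ∀ {u v w} → Adj G u v → Adj G u w → colour u v ≡ colour u w → v ≡ w
    colour-proper' {u} {v} {w} uv uw same =
      let γ , ψuv = justWitness (ψ u v) (coloured uv)
          δ , ψuw = justWitness (ψ u w) (coloured uw)
          γ≡δ = trans (cong (fromMaybe fzero) (sym ψuv)) (trans same (cong (fromMaybe fzero) ψuw))
      in proper ψ-proper u v w γ ψuv (trans ψuw (cong just (sym γ≡δ)))

open ProperEdgeColouring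

classGraph : ∀ {n C} → Colouring n C → Fin C → Graph
classGraph {n} c α = record
  { size = n
  ; Adj = λ x y → y ≢ x × col c x y ≡ α
  ; sym = λ {x} {y} (y≢x , xy) → (y≢x ∘ sym) , trans (col-sym c y x) xy
  ; irrefl = λ (x≢x , _) → x≢x refl
  }

classAdj? : ∀ {n C} (c : Colouring n C) (α : Fin C) → ∀ x y → Dec (Adj (classGraph c α) x y)
classAdj? c α x y = ¬? (y ≟ x) ×-dec (col c x y ≟ α)

-- In a b-bounded colouring every colour class has maximum degree at most b: b + 1 distinct
-- neighbours of x in the class of α would occupy distinct positions in the list whose length
-- is the α-degree of x.
classGraph-maxDegree : ∀ {n C b} (c : Colouring n C) → Bounded b c →
  ∀ α → MaxDegree≤ (classGraph c α) b
classGraph-maxDegree {n} {b = b} c bounded α x f f-injective adj =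
  <-irrefl refl (≤-trans (injective⇒≤ {f = position} position-injective) (bounded x α))
  where
  neighbours : List (Fin n)
  neighbours = filter (λ y → ¬? (y ≟ x) ×-dec (col c x y ≟ α)) (allFin n)
  listed : ∀ i → f i ∈ neighbours
  listed i = ∈-filter⁺ (λ y → ¬? (y ≟ x) ×-dec (col c x y ≟ α)) (∈-allFin (f i)) (adj i)
  position : Fin (suc b) → Fin (length neighbours)
  position i = index (listed i)
  position-injective : Injective _≡_ _≡_ position
  position-injective {i} {j} e = f-injective
    (trans (lookup-index (listed i)) (trans (cong (lookup neighbours) e) (sym (lookup-index (listed j)))))

refineByClasses : ∀ {n C k} (c : Colouring n C) → (∀ α → ProperEdgeColouring (classGraph c α) k) →
  Colouring n (k * C)
refineByClasses {n} {C} {k} c φ = record { col = pairColour ; col-sym = pairColour-sym }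
  where
  pairColour : Fin n → Fin n → Fin (k * C)
  pairColour u v = combine (colour (φ (col c u v)) u v) (col c u v)
  pairColour-sym : ∀ u v → pairColour u v ≡ pairColour v u
  pairColour-sym u v =
    subst (λ α → pairColour u v ≡ combine (colour (φ α) v u) α) (col-sym c u v)
      (cong (λ i → combine i (col c u v)) (colour-sym (φ (col c u v)) u v))

refineByClasses-refines : ∀ {n C k} (c : Colouring n C)
  (φ : ∀ α → ProperEdgeColouring (classGraph c α) k) →
  Refines (refineByClasses c φ) c
refineByClasses-refines c φ u v u' v' _ _ =
  combine-injectiveʳ (colour (φ (col c u v)) u v) (col c u v) (colour (φ (col c u' v')) u' v') (col c u' v')

refineByClasses-proper : ∀ {n C k} (c : Colouring n C)
  (φ : ∀ α → ProperEdgeColouring (classGraph c α) k) →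
  Proper (refineByClasses c φ)
refineByClasses-proper c φ u v w v≢u w≢u v≢w same
  with combine-injective (colour (φ (col c u v)) u v) (col c u v) (colour (φ (col c u w)) u w) (col c u w) same
... | sameClassColour , sameClass =
  v≢w (colour-proper (φ (col c u v)) (v≢u , refl) (w≢u , sym sameClass)
        (trans sameClassColour (cong (λ α → colour (φ α) u w) (sym sameClass))))

refinement-reflects-colourIso : ∀ {n C C'} (H : Graph) (c' : Colouring n C') (c : Colouring n C) →
  Refines c' c → ∀ p q → ColourIso {H} c' p q → ColourIso {H} c p q
refinement-reflects-colourIso H c' c refines (f , f-injective) (g , g-injective)
                              (σ , σ-automorphism , sameColour) =
  σ , σ-automorphism , λ x y xy →
    refines (f x) (f y) (g (Inverse.to σ x)) (g (Inverse.to σ y))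
      (λ e → irrefl H (subst (Adj H x) (sym (f-injective e)) xy))
      (λ e → irrefl H (subst (Adj H (Inverse.to σ x)) (sym (g-injective e))
                        (proj₁ (σ-automorphism x y) xy)))
      (sameColour x y xy)

refinement-reflects-repeats : ∀ {n C C'} (H : Graph) (k : ℕ) (c' : Colouring n C') (c : Colouring n C) →
  Refines c' c → Repeat H k c' → Repeat H k c
refinement-reflects-repeats H k c' c refines (F , repeat) =
  F , λ i j i≢j →
    proj₁ (repeat i j i≢j) , refinement-reflects-colourIso H c' c refines (F i) (F j) (proj₂ (repeat i j i≢j))

proposition2p4 : (H : Graph) (b k n C : ℕ) → 2 ≤ b → 2 ≤ k → 2 ≤ n →
    (c : Colouring n C) → Bounded b c → ¬ Repeat H k c →
    Σ (Colouring n ((b + 1) * C)) λ c' →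
      Refines c' c × Proper c' × ¬ Repeat H k c'
proposition2p4 H b k n C _ _ _ c bounded noRepeat =
  c' , refineByClasses-refines c classColouring , refineByClasses-proper c classColouring ,
  noRepeat ∘ refinement-reflects-repeats H k c' c (refineByClasses-refines c classColouring)
  where
  classColouring : ∀ α → ProperEdgeColouring (classGraph c α) (b + 1)
  classColouring α = subst (ProperEdgeColouring (classGraph c α)) (+-comm 1 b)
    (Vizing.vizing (classGraph c α) (classAdj? c α) b (classGraph-maxDegree c bounded α))
  c' : Colouring n ((b + 1) * C)
  c' = refineByClasses c classColouring
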